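{- Let $Q$ be the quiver with vertices $1,2,3,4,5$ and single arrows $3\to4$, $4\to5$, $5\to3$, $1\to4$, $5\to1$, $1\to2$, $2\to5$, $2\to3$. Then $Q$ does not have any admissible quasi-Cartan companion, and hence $Q$ is not mutation-acyclic.
   Context: A quiver is a finite directed multigraph with no loops and no oriented 2-cycles; for a quiver on vertices $1,\dots,n$, $B=(b_{ij})$ is the skew-symmetric matrix with $b_{ij}$ equal to the number of arrows $i\to j$ minus the number of arrows $j\to i$. A quasi-Cartan companion of $Q$ is a symmetric integer matrix $A=(a_{ij})$ with $a_{ii}=2$ and $|a_{ij}|=|b_{ij}|$ for $i\ne j$. A cycle in $Q$ is an induced subquiver whose vertices can be labelled by $\mathbb{Z}/k\mathbb{Z}$ so that the only pairs of adjacent vertices are $\{i,i+1\}$, $i\in\mathbb{Z}/k\mathbb{Z}$. $A$ is admissible if for every cycle $Z$ of $Q$: if $Z$ is an oriented cycle, the number of edges $\{i,j\}$ of $Z$ with $a_{ij}>0$ is odd, and if $Z$ is non-oriented, this number is even. Mutation $\mu_k$: for every path $i\to k\to j$ add an arrow $i\to j$, reverse all arrows at $k$, delete a maximal collection of oriented 2-cycles. $Q$ is mutation-acyclic if some quiver obtained from $Q$ by a sequence of mutations has no oriented cycles. -}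

module Defs where

open import Data.Nat as ℕ using (ℕ; zero; suc; _%_)
open import Data.Integer as ℤ using (ℤ; +_; _-_; _*_; _⊔_; ∣_∣; 0ℤ)
open import Data.Fin using (Fin; zero; suc; toℕ; fromℕ<; _≟_)
open import Data.Bool using (Bool; true; false; if_then_else_)
open import Data.List using (List; []; _∷_)
open import Data.Product using (Σ; _×_; ∃)
open import Data.Sum using (_⊎_)
open import Relation.Nullary using (¬_; does; yes; no)
open import Relation.Binary.PropositionalEquality using (_≡_)
open import Function using (_⇔_)
open import Function.Definitions using (Injective)

-- A quiver on vertices Fin n is encoded by its skew-symmetric exchange
-- matrix B, b i j = #(arrows i → j) - #(arrows j → i).
Matrix : ℕ → Set
Matrix n = Fin n → Fin n → ℤ

-- The quiver Q of the statement: vertex i (1..5) is Fin 5 element i-1.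
-- Arrows: 3→4, 4→5, 5→3, 1→4, 5→1, 1→2, 2→5, 2→3.
arrQ : Fin 5 → Fin 5 → ℕ
arrQ (suc (suc zero)) (suc (suc (suc zero))) = 1
arrQ (suc (suc (suc zero))) (suc (suc (suc (suc zero)))) = 1
arrQ (suc (suc (suc (suc zero)))) (suc (suc zero)) = 1
arrQ zero (suc (suc (suc zero))) = 1
arrQ (suc (suc (suc (suc zero)))) zero = 1
arrQ zero (suc zero) = 1
arrQ (suc zero) (suc (suc (suc (suc zero)))) = 1
arrQ (suc zero) (suc (suc zero)) = 1
arrQ _ _ = 0

BQ : Matrix 5
BQ i j = + arrQ i j - + arrQ j i

IsQuasiCartanCompanion : ∀ {n} → Matrix n → Matrix n → Set
IsQuasiCartanCompanion {n} B A =
  (∀ i j → A i j ≡ A j i) ×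
  (∀ i → A i i ≡ + 2) ×
  (∀ i j → ¬ (i ≡ j) → ∣ A i j ∣ ≡ ∣ B i j ∣)

csuc : ∀ {k} → Fin (suc k) → Fin (suc k)
csuc {k} i with ℕ._<?_ (suc (toℕ i)) (suc k)
... | yes p = fromℕ< p
... | no _ = zero

Adjacent : ∀ {n} → Matrix n → Fin n → Fin n → Set
Adjacent B i j = ¬ (B i j ≡ 0ℤ)

record Cycle {n : ℕ} (B : Matrix n) : Set where
  field
    m      : ℕ
    vert   : Fin (suc (suc (suc m))) → Fin n
    inj    : Injective _≡_ _≡_ vert
    adjIff : ∀ p q → ¬ (p ≡ q) →
             (Adjacent B (vert p) (vert q) ⇔ (q ≡ csuc p ⊎ p ≡ csuc q))

open Cycle public

IsOriented : ∀ {n} {B : Matrix n} → Cycle B → Set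
IsOriented {B = B} Z =
  (∀ p → ℤ._<_ 0ℤ (B (vert Z p) (vert Z (csuc p)))) ⊎
  (∀ p → ℤ._<_ (B (vert Z p) (vert Z (csuc p))) 0ℤ)

countF : ∀ {k} → (Fin k → Bool) → ℕ
countF {zero} f = 0
countF {suc k} f = (if f zero then 1 else 0) ℕ.+ countF (λ i → f (suc i))

posEdges : ∀ {n} {B : Matrix n} → Matrix n → Cycle B → ℕ
posEdges A Z = countF (λ p → does (ℤ._<?_ 0ℤ (A (vert Z p) (vert Z (csuc p)))))

IsAdmissible : ∀ {n} → Matrix n → Matrix n → Set
IsAdmissible B A = ∀ (Z : Cycle B) →
  (IsOriented Z → posEdges A Z % 2 ≡ 1) ×
  (¬ IsOriented Z → posEdges A Z % 2 ≡ 0)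

-- Quiver mutation at k, in terms of the exchange matrix: for i,j ≠ k,
-- add [b_ik]_+ [b_kj]_+ arrows i → j (paths i → k → j) and
-- [b_jk]_+ [b_ki]_+ arrows j → i, then cancel 2-cycles; reverse arrows at k.
pos : ℤ → ℤ
pos x = 0ℤ ⊔ x

mutate : ∀ {n} → Fin n → Matrix n → Matrix n
mutate k B i j with does (i ≟ k) | does (j ≟ k)
... | false | false = B i j ℤ.+ pos (B i k) * pos (B k j) - pos (B j k) * pos (B k i)
... | _ | _ = ℤ.- B i j

mutateSeq : ∀ {n} → List (Fin n) → Matrix n → Matrix n
mutateSeq [] B = B
mutateSeq (k ∷ ks) B = mutateSeq ks (mutate k B)

IsAcyclic : ∀ {n} → Matrix n → Set
IsAcyclic {n} B = ∀ (k : ℕ) (w : Fin (suc k) → Fin n) →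
  ¬ (∀ p → ℤ._<_ 0ℤ (B (w p) (w (csuc p))))

IsMutationAcyclic : ∀ {n} → Matrix n → Set
IsMutationAcyclic B = ∃ λ (ks : List _) → IsAcyclic (mutateSeq ks B)

-- Q has five chordless cycles: the oriented triangles {3,4,5}, {1,4,5},
-- {1,2,5} and the non-oriented cycles {2,3,5}, {1,2,3,4}.  Each of their
-- eight edges lies on exactly two of them, so adding up the parities that
-- admissibility prescribes for the numbers of positive edges gives
-- 0 ≡ 1 + 1 + 1 + 0 + 0 (mod 2).
--
-- Instead of deriving non-mutation-acyclicity from this (via Seven's
-- theorem), we exhibit the mutation class of Q: up to relabelling of the
-- vertices it consists of ten quivers, each with an oriented cycle.  For
-- every representative and every vertex the certificate names the
-- representative reached by mutation and the relabelling, and is checked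
-- by evaluation.
module Submission where

open import Defs
open import Data.Bool using (true; false; if_then_else_)
open import Data.Fin using (Fin; _≟_)
open import Data.Fin.Patterns using (0F; 1F; 2F; 3F; 4F; 5F; 6F; 7F; 8F; 9F)
open import Data.Fin.Permutation
  using (Permutation′; permutation; _⟨$⟩ʳ_; _⟨$⟩ˡ_; inverseˡ; inverseʳ; _∘ₚ_)
open import Data.Fin.Properties using (any?; all?)
open import Data.Integer as ℤ using (0ℤ; +_; _-_)
open import Data.List using (List; []; _∷_; length; filter)
open import Data.Nat using (ℕ; suc; _+_; _*_; _%_)
open import Data.Nat.DivMod using (%-distribˡ-+; m*n%n≡0)
open import Data.Nat.Properties using (1+n≢0)
open import Data.Nat.Tactic.RingSolver using (solve-∀)
open import Data.Product using (∃; _×_; _,_; proj₁; proj₂)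
open import Data.Product.Properties using (≡-dec)
open import Data.Sum using (_⊎_)
open import Data.Vec using (Vec; []; _∷_; lookup)
open import Function.Bundles using (_⇔_; mk⇔; module Equivalence)
open import Relation.Binary.PropositionalEquality
  using (_≡_; _≢_; refl; sym; trans; cong; cong₂; subst; module ≡-Reasoning)
open import Relation.Nullary using (¬_; Dec; does; yes; no)
open import Relation.Nullary.Decidable
  using (True; False; toWitness; toWitnessFalse; does-⇔; map′; ¬?; _×-dec_; _⊎-dec_; _→-dec_)

private
  variable
    n k : ℕ

_⇔-dec_ : ∀ {a b} {A : Set a} {B : Set b} → Dec A → Dec B → Dec (A ⇔ B)
a? ⇔-dec b? =
  map′ (λ (to , from) → mk⇔ to from) (λ A⇔B → Equivalence.to A⇔B , Equivalence.from A⇔B)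
       ((a? →-dec b?) ×-dec (b? →-dec a?))

-- Chordless cycles and the parity obstruction

IsCycleLabelling : Matrix n → Vec (Fin n) (3 + k) → Set
IsCycleLabelling B w =
  (∀ p q → lookup w p ≡ lookup w q → p ≡ q) ×
  (∀ p q → p ≢ q → Adjacent B (lookup w p) (lookup w q) ⇔ (q ≡ csuc p ⊎ p ≡ csuc q))

isCycleLabelling? : (B : Matrix n) (w : Vec (Fin n) (3 + k)) → Dec (IsCycleLabelling B w)
isCycleLabelling? B w =
  all? (λ p → all? λ q → (lookup w p ≟ lookup w q) →-dec (p ≟ q)) ×-dec
  all? λ p → all? λ q → ¬? (p ≟ q) →-dec
    (¬? (B (lookup w p) (lookup w q) ℤ.≟ 0ℤ) ⇔-dec ((q ≟ csuc p) ⊎-dec (p ≟ csuc q)))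

cycleOf : (B : Matrix n) (w : Vec (Fin n) (3 + k)) → {True (isCycleLabelling? B w)} → Cycle B
cycleOf {k = k} B w {labelling} with toWitness labelling
... | injective , adjacent =
  record { m = k ; vert = lookup w ; inj = injective _ _ ; adjIff = adjacent }

isOriented? : {B : Matrix n} (Z : Cycle B) → Dec (IsOriented Z)
isOriented? {B = B} Z = all? (λ p → 0ℤ ℤ.<? edge p) ⊎-dec all? (λ p → edge p ℤ.<? 0ℤ)
  where edge = λ p → B (vert Z p) (vert Z (csuc p))

Z₃₄₅ Z₁₄₅ Z₁₂₅ Z₂₃₅ Z₁₂₃₄ : Cycle BQ
Z₃₄₅  = cycleOf BQ (2F ∷ 3F ∷ 4F ∷ [])
Z₁₄₅  = cycleOf BQ (0F ∷ 3F ∷ 4F ∷ [])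
Z₁₂₅  = cycleOf BQ (0F ∷ 1F ∷ 4F ∷ [])
Z₂₃₅  = cycleOf BQ (4F ∷ 2F ∷ 1F ∷ [])
Z₁₂₃₄ = cycleOf BQ (0F ∷ 1F ∷ 2F ∷ 3F ∷ [])

-- The left-hand side lists the edges of Z₃₄₅, Z₁₄₅, Z₁₂₅, Z₂₃₅, Z₁₂₃₄ in
-- the shape posEdges unfolds to.
edge-double-count : ∀ x01 x03 x12 x14 x23 x34 x40 x42 →
  (x23 + (x34 + (x42 + 0))) + (x03 + (x34 + (x40 + 0))) + (x01 + (x14 + (x40 + 0)))
    + (x42 + (x12 + (x14 + 0))) + (x01 + (x12 + (x23 + (x03 + 0))))
  ≡ (x01 + x03 + x12 + x14 + x23 + x34 + x40 + x42) * 2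
edge-double-count = solve-∀

parity-+ : ∀ m n {a b} → m % 2 ≡ a → n % 2 ≡ b → (m + n) % 2 ≡ (a + b) % 2
parity-+ m n refl refl = %-distribˡ-+ m n 2

parity-clash : ∀ a b c d e s → a % 2 ≡ 1 → b % 2 ≡ 1 → c % 2 ≡ 1 → d % 2 ≡ 0 → e % 2 ≡ 0 →
               a + b + c + d + e ≢ s * 2
parity-clash a b c d e s a-odd b-odd c-odd d-even e-even sum≡ = 1+n≢0 (begin
  1                       ≡⟨ sym sum-odd ⟩
  (a + b + c + d + e) % 2 ≡⟨ cong (_% 2) sum≡ ⟩
  (s * 2) % 2             ≡⟨ m*n%n≡0 s 2 ⟩
  0                       ∎)
  where
  open ≡-Reasoning
  sum-odd : (a + b + c + d + e) % 2 ≡ 1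
  sum-odd = parity-+ (a + b + c + d) e (parity-+ (a + b + c) d
              (parity-+ (a + b) c (parity-+ a b a-odd b-odd) c-odd) d-even) e-even

no-admissible-companion : ¬ ∃ λ A → IsQuasiCartanCompanion BQ A × IsAdmissible BQ A
no-admissible-companion (A , (A-sym , _) , admissible) =
  parity-clash (posEdges A Z₃₄₅) (posEdges A Z₁₄₅) (posEdges A Z₁₂₅)
               (posEdges A Z₂₃₅) (posEdges A Z₁₂₃₄) edges
    (odd Z₃₄₅) (odd Z₁₄₅) (odd Z₁₂₅) (even Z₂₃₅) (even Z₁₂₃₄) each-edge-twice
  where
  odd : (Z : Cycle BQ) → {True (isOriented? Z)} → posEdges A Z % 2 ≡ 1
  odd Z {oriented} = proj₁ (admissible Z) (toWitness oriented)

  even : (Z : Cycle BQ) → {False (isOriented? Z)} → posEdges A Z % 2 ≡ 0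
  even Z {non-oriented} = proj₂ (admissible Z) (toWitnessFalse non-oriented)

  positive : Fin 5 → Fin 5 → ℕ
  positive i j = if does (0ℤ ℤ.<? A i j) then 1 else 0

  positive-sym : ∀ i j → positive i j ≡ positive j i
  positive-sym i j = cong (λ a → if does (0ℤ ℤ.<? a) then 1 else 0) (A-sym i j)

  edges : ℕ
  edges = positive 0F 1F + positive 0F 3F + positive 1F 2F + positive 1F 4F
        + positive 2F 3F + positive 3F 4F + positive 4F 0F + positive 4F 2F

  each-edge-twice : posEdges A Z₃₄₅ + posEdges A Z₁₄₅ + posEdges A Z₁₂₅
                  + posEdges A Z₂₃₅ + posEdges A Z₁₂₃₄ ≡ edges * 2
  each-edge-twice rewrite positive-sym 2F 1F | positive-sym 3F 0F =
    edge-double-count (positive 0F 1F) (positive 0F 3F) (positive 1F 2F) (positive 1F 4F)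
                      (positive 2F 3F) (positive 3F 4F) (positive 4F 0F) (positive 4F 2F)

-- Relabelling the vertices of a quiver

infix 4 _≅_
record _≅_ (B R : Matrix n) : Set where
  constructor _,_
  field
    π : Permutation′ n
    relabels : ∀ i j → B i j ≡ R (π ⟨$⟩ʳ i) (π ⟨$⟩ʳ j)

≅-trans : {B R S : Matrix n} → B ≅ R → R ≅ S → B ≅ S
≅-trans (π , B≡R) (ρ , R≡S) = π ∘ₚ ρ , λ i j → trans (B≡R i j) (R≡S _ _)

≅-acyclic : {B R : Matrix n} → B ≅ R → IsAcyclic B → IsAcyclic R
≅-acyclic {R = R} (π , B≡R) acyclic k w cycle =
  acyclic k (λ p → π ⟨$⟩ˡ w p) λ p →
    subst (ℤ._<_ 0ℤ) (sym (trans (B≡R _ _) (cong₂ R (inverseʳ π) (inverseʳ π)))) (cycle p)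

does-≟-permute : (π : Permutation′ n) (i k : Fin n) → does (i ≟ k) ≡ does (π ⟨$⟩ʳ i ≟ π ⟨$⟩ʳ k)
does-≟-permute π i k = does-⇔ (mk⇔ (cong (π ⟨$⟩ʳ_)) injective) (i ≟ k) (π ⟨$⟩ʳ i ≟ π ⟨$⟩ʳ k)
  where
  injective : π ⟨$⟩ʳ i ≡ π ⟨$⟩ʳ k → i ≡ k
  injective eq = trans (sym (inverseˡ π)) (trans (cong (π ⟨$⟩ˡ_) eq) (inverseˡ π))

mutate-≅ : {B R : Matrix n} (B≅R : B ≅ R) (k : Fin n) → mutate k B ≅ mutate (_≅_.π B≅R ⟨$⟩ʳ k) R
mutate-≅ {B = B} {R} (π , B≡R) k = π , entry
  where
  entry : ∀ i j → mutate k B i j ≡ mutate (π ⟨$⟩ʳ k) R (π ⟨$⟩ʳ i) (π ⟨$⟩ʳ j)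
  entry i j rewrite does-≟-permute π i k | does-≟-permute π j k
    with does (π ⟨$⟩ʳ i ≟ π ⟨$⟩ʳ k) | does (π ⟨$⟩ʳ j ≟ π ⟨$⟩ʳ k)
  ... | true  | _     = cong ℤ.-_ (B≡R i j)
  ... | false | true  = cong ℤ.-_ (B≡R i j)
  ... | false | false rewrite B≡R i j | B≡R i k | B≡R k j | B≡R j k | B≡R k i = refl

module _ {c : ℕ} (rep : Fin c → Matrix n)
         (closed : ∀ r k → ∃ λ r′ → mutate k (rep r) ≅ rep r′) where

  mutateSeq-≅ : ∀ {B r} → B ≅ rep r → ∀ ks → ∃ λ r′ → mutateSeq ks B ≅ rep r′
  mutateSeq-≅ {r = r} B≅R [] = r , B≅R
  mutateSeq-≅ {r = r} B≅R@(π , _) (k ∷ ks) =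
    let r′ , M≅R′ = closed r (π ⟨$⟩ʳ k) in mutateSeq-≅ (≅-trans (mutate-≅ B≅R k) M≅R′) ks

  cyclic-class⇒¬mutationAcyclic : (∀ r → ¬ IsAcyclic (rep r)) →
                                   ∀ {B r} → B ≅ rep r → ¬ IsMutationAcyclic B
  cyclic-class⇒¬mutationAcyclic cyclic B≅R (ks , acyclic) =
    let r′ , M≅R′ = mutateSeq-≅ B≅R ks in cyclic r′ (≅-acyclic M≅R′ acyclic)

-- Checkable certificates for a mutation class

-- When σ misses j the junk value j is returned; RelabelledBy then fails.
preimage : (Fin n → Fin n) → Fin n → Fin n
preimage σ j with any? (λ i → σ i ≟ j)
... | yes (i , _) = i
... | no _        = j

RelabelledBy : (Fin n → Fin n) → Matrix n → Matrix n → Set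
RelabelledBy σ B R =
  (∀ i → σ (preimage σ i) ≡ i) × (∀ i → preimage σ (σ i) ≡ i) × (∀ i j → B i j ≡ R (σ i) (σ j))

relabelledBy? : ∀ σ (B R : Matrix n) → Dec (RelabelledBy σ B R)
relabelledBy? σ B R =
  all? (λ i → σ (preimage σ i) ≟ i) ×-dec all? (λ i → preimage σ (σ i) ≟ i) ×-dec
  all? λ i → all? λ j → B i j ℤ.≟ R (σ i) (σ j)

relabelledBy⇒≅ : ∀ σ {B R : Matrix n} → RelabelledBy σ B R → B ≅ R
relabelledBy⇒≅ σ (inverseʳ , inverseˡ , B≡R) = permutation σ (preimage σ) inverseʳ inverseˡ , B≡R

IsOrientedCycle : Matrix n → Vec (Fin n) (suc k) → Set
IsOrientedCycle B w = ∀ p → ℤ._<_ 0ℤ (B (lookup w p) (lookup w (csuc p)))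

isOrientedCycle? : (B : Matrix n) (w : Vec (Fin n) (suc k)) → Dec (IsOrientedCycle B w)
isOrientedCycle? B w = all? λ p → 0ℤ ℤ.<? B (lookup w p) (lookup w (csuc p))

quiver : List (Fin n × Fin n) → Matrix n
quiver as i j = + length (filter (_≟ₐ (i , j)) as) - + length (filter (_≟ₐ (j , i)) as)
  where _≟ₐ_ = ≡-dec _≟_ _≟_

infix 6 _⟶_ _via_
_⟶_ : Fin n → Fin n → Fin n × Fin n
_⟶_ = _,_

record Relabelled (n c : ℕ) : Set where
  constructor _via_
  field
    target      : Fin c
    relabelling : Vec (Fin n) n

record Representative (n c : ℕ) : Set where
  constructor representative
  field
    arrows        : List (Fin n × Fin n)
    orientedCycle : ∃ λ k → Vec (Fin n) (suc k)
    mutations     : Vec (Relabelled n c) n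

  matrix : Matrix n
  matrix = quiver arrows

module _ {c : ℕ} (reps : Vec (Representative n c) c) where
  open Representative

  rep : Fin c → Matrix n
  rep r = matrix (lookup reps r)

  IsCertifiedMutation : Matrix n → Fin n → Relabelled n c → Set
  IsCertifiedMutation B k (r′ via σ) = RelabelledBy (lookup σ) (mutate k B) (rep r′)

  isCertifiedMutation? : ∀ B k m → Dec (IsCertifiedMutation B k m)
  isCertifiedMutation? B k (r′ via σ) = relabelledBy? (lookup σ) (mutate k B) (rep r′)

  IsCertified : Representative n c → Set
  IsCertified e = IsOrientedCycle (matrix e) (proj₂ (orientedCycle e)) ×
                  ∀ k → IsCertifiedMutation (matrix e) k (lookup (mutations e) k)

  isCertified? : ∀ e → Dec (IsCertified e)
  isCertified? e = isOrientedCycle? (matrix e) (proj₂ (orientedCycle e)) ×-dec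
                   all? λ k → isCertifiedMutation? (matrix e) k (lookup (mutations e) k)

  certified⇒¬mutationAcyclic : (∀ r → IsCertified (lookup reps r)) →
                               ∀ {B r} → B ≅ rep r → ¬ IsMutationAcyclic B
  certified⇒¬mutationAcyclic certified = cyclic-class⇒¬mutationAcyclic rep closed cyclic
    where
    closed : ∀ r k → ∃ λ r′ → mutate k (rep r) ≅ rep r′
    closed r k with lookup (mutations (lookup reps r)) k | proj₂ (certified r) k
    ... | r′ via σ | relabelled = r′ , relabelledBy⇒≅ (lookup σ) relabelled

    cyclic : ∀ r → ¬ IsAcyclic (rep r)
    cyclic r acyclic = acyclic _ (lookup (proj₂ (orientedCycle (lookup reps r)))) (proj₁ (certified r))

-- Representative 0F is Q itself, with vertex i of the paper numbered i - 1.
mutationClassOfQ : Vec (Representative 5 10) 10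
mutationClassOfQ =
    representative
      (0F ⟶ 1F ∷ 0F ⟶ 3F ∷ 1F ⟶ 2F ∷ 1F ⟶ 4F ∷ 2F ⟶ 3F ∷ 3F ⟶ 4F ∷ 4F ⟶ 0F ∷ 4F ⟶ 2F ∷ [])
      (_ , 0F ∷ 1F ∷ 4F ∷ [])
      ( 1F via (0F ∷ 1F ∷ 2F ∷ 3F ∷ 4F ∷ [])
      ∷ 2F via (0F ∷ 1F ∷ 2F ∷ 3F ∷ 4F ∷ [])
      ∷ 2F via (0F ∷ 2F ∷ 4F ∷ 3F ∷ 1F ∷ [])
      ∷ 3F via (0F ∷ 1F ∷ 2F ∷ 3F ∷ 4F ∷ [])
      ∷ 4F via (0F ∷ 1F ∷ 2F ∷ 3F ∷ 4F ∷ [])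
      ∷ [])
  ∷ representative
      (0F ⟶ 4F ∷ 1F ⟶ 0F ∷ 1F ⟶ 2F ∷ 2F ⟶ 3F ∷ 3F ⟶ 0F ∷ 4F ⟶ 2F ∷ [])
      (_ , 0F ∷ 4F ∷ 2F ∷ 3F ∷ [])
      ( 0F via (0F ∷ 1F ∷ 2F ∷ 3F ∷ 4F ∷ [])
      ∷ 3F via (1F ∷ 2F ∷ 3F ∷ 0F ∷ 4F ∷ [])
      ∷ 0F via (2F ∷ 1F ∷ 0F ∷ 4F ∷ 3F ∷ [])
      ∷ 5F via (0F ∷ 1F ∷ 2F ∷ 3F ∷ 4F ∷ [])
      ∷ 5F via (2F ∷ 1F ∷ 0F ∷ 3F ∷ 4F ∷ [])
      ∷ [])
  ∷ representative
      (0F ⟶ 2F ∷ 0F ⟶ 3F ∷ 1F ⟶ 0F ∷ 2F ⟶ 1F ∷ 2F ⟶ 3F ∷ 3F ⟶ 4F ∷ 4F ⟶ 1F ∷ 4F ⟶ 2F ∷ [])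
      (_ , 0F ∷ 2F ∷ 1F ∷ [])
      ( 0F via (2F ∷ 3F ∷ 1F ∷ 4F ∷ 0F ∷ [])
      ∷ 0F via (0F ∷ 1F ∷ 2F ∷ 3F ∷ 4F ∷ [])
      ∷ 6F via (0F ∷ 1F ∷ 2F ∷ 3F ∷ 4F ∷ [])
      ∷ 0F via (4F ∷ 3F ∷ 2F ∷ 1F ∷ 0F ∷ [])
      ∷ 0F via (0F ∷ 4F ∷ 1F ∷ 3F ∷ 2F ∷ [])
      ∷ [])
  ∷ representative
      (0F ⟶ 1F ∷ 1F ⟶ 2F ∷ 1F ⟶ 4F ∷ 3F ⟶ 0F ∷ 3F ⟶ 2F ∷ 4F ⟶ 3F ∷ [])
      (_ , 0F ∷ 1F ∷ 4F ∷ 3F ∷ [])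
      ( 7F via (0F ∷ 1F ∷ 2F ∷ 3F ∷ 4F ∷ [])
      ∷ 0F via (4F ∷ 3F ∷ 2F ∷ 1F ∷ 0F ∷ [])
      ∷ 1F via (3F ∷ 0F ∷ 1F ∷ 2F ∷ 4F ∷ [])
      ∷ 0F via (0F ∷ 1F ∷ 2F ∷ 3F ∷ 4F ∷ [])
      ∷ 7F via (0F ∷ 3F ∷ 2F ∷ 1F ∷ 4F ∷ [])
      ∷ [])
  ∷ representative
      (0F ⟶ 4F ∷ 1F ⟶ 2F ∷ 1F ⟶ 2F ∷ 2F ⟶ 4F ∷ 4F ⟶ 1F ∷ 4F ⟶ 3F ∷ [])
      (_ , 1F ∷ 2F ∷ 4F ∷ [])
      ( 8F via (0F ∷ 1F ∷ 2F ∷ 3F ∷ 4F ∷ [])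
      ∷ 4F via (0F ∷ 2F ∷ 1F ∷ 3F ∷ 4F ∷ [])
      ∷ 4F via (0F ∷ 2F ∷ 1F ∷ 3F ∷ 4F ∷ [])
      ∷ 9F via (0F ∷ 1F ∷ 2F ∷ 3F ∷ 4F ∷ [])
      ∷ 0F via (0F ∷ 1F ∷ 2F ∷ 3F ∷ 4F ∷ [])
      ∷ [])
  ∷ representative
      (0F ⟶ 3F ∷ 0F ⟶ 4F ∷ 1F ⟶ 0F ∷ 1F ⟶ 2F ∷ 2F ⟶ 0F ∷ 3F ⟶ 2F ∷ 4F ⟶ 2F ∷ [])
      (_ , 0F ∷ 3F ∷ 2F ∷ [])
      ( 7F via (3F ∷ 1F ∷ 2F ∷ 0F ∷ 4F ∷ [])
      ∷ 7F via (1F ∷ 2F ∷ 3F ∷ 0F ∷ 4F ∷ [])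
      ∷ 8F via (2F ∷ 1F ∷ 4F ∷ 0F ∷ 3F ∷ [])
      ∷ 1F via (0F ∷ 1F ∷ 2F ∷ 3F ∷ 4F ∷ [])
      ∷ 1F via (0F ∷ 1F ∷ 2F ∷ 4F ∷ 3F ∷ [])
      ∷ [])
  ∷ representative
      (0F ⟶ 3F ∷ 0F ⟶ 3F ∷ 1F ⟶ 2F ∷ 2F ⟶ 0F ∷ 2F ⟶ 4F ∷ 3F ⟶ 2F ∷ 4F ⟶ 1F ∷ 4F ⟶ 1F ∷ [])
      (_ , 0F ∷ 3F ∷ 2F ∷ [])
      ( 6F via (1F ∷ 3F ∷ 2F ∷ 4F ∷ 0F ∷ [])
      ∷ 6F via (0F ∷ 4F ∷ 2F ∷ 3F ∷ 1F ∷ [])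
      ∷ 2F via (0F ∷ 1F ∷ 2F ∷ 3F ∷ 4F ∷ [])
      ∷ 6F via (1F ∷ 3F ∷ 2F ∷ 4F ∷ 0F ∷ [])
      ∷ 6F via (0F ∷ 4F ∷ 2F ∷ 3F ∷ 1F ∷ [])
      ∷ [])
  ∷ representative
      (0F ⟶ 3F ∷ 1F ⟶ 0F ∷ 1F ⟶ 2F ∷ 1F ⟶ 4F ∷ 3F ⟶ 1F ∷ 3F ⟶ 2F ∷ 4F ⟶ 3F ∷ [])
      (_ , 0F ∷ 3F ∷ 1F ∷ [])
      ( 3F via (0F ∷ 1F ∷ 2F ∷ 3F ∷ 4F ∷ [])
      ∷ 9F via (0F ∷ 4F ∷ 2F ∷ 1F ∷ 3F ∷ [])
      ∷ 5F via (3F ∷ 0F ∷ 1F ∷ 2F ∷ 4F ∷ [])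
      ∷ 5F via (3F ∷ 1F ∷ 2F ∷ 0F ∷ 4F ∷ [])
      ∷ 3F via (0F ∷ 3F ∷ 2F ∷ 1F ∷ 4F ∷ [])
      ∷ [])
  ∷ representative
      (1F ⟶ 2F ∷ 1F ⟶ 2F ∷ 2F ⟶ 4F ∷ 4F ⟶ 0F ∷ 4F ⟶ 1F ∷ 4F ⟶ 3F ∷ [])
      (_ , 1F ∷ 2F ∷ 4F ∷ [])
      ( 4F via (0F ∷ 1F ∷ 2F ∷ 3F ∷ 4F ∷ [])
      ∷ 8F via (0F ∷ 2F ∷ 1F ∷ 3F ∷ 4F ∷ [])
      ∷ 8F via (0F ∷ 2F ∷ 1F ∷ 3F ∷ 4F ∷ [])
      ∷ 4F via (3F ∷ 1F ∷ 2F ∷ 0F ∷ 4F ∷ [])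
      ∷ 5F via (3F ∷ 1F ∷ 0F ∷ 4F ∷ 2F ∷ [])
      ∷ [])
  ∷ representative
      (0F ⟶ 4F ∷ 1F ⟶ 2F ∷ 1F ⟶ 2F ∷ 2F ⟶ 4F ∷ 3F ⟶ 4F ∷ 4F ⟶ 1F ∷ [])
      (_ , 1F ∷ 2F ∷ 4F ∷ [])
      ( 4F via (3F ∷ 1F ∷ 2F ∷ 0F ∷ 4F ∷ [])
      ∷ 9F via (0F ∷ 2F ∷ 1F ∷ 3F ∷ 4F ∷ [])
      ∷ 9F via (0F ∷ 2F ∷ 1F ∷ 3F ∷ 4F ∷ [])
      ∷ 4F via (0F ∷ 1F ∷ 2F ∷ 3F ∷ 4F ∷ [])
      ∷ 7F via (0F ∷ 3F ∷ 2F ∷ 4F ∷ 1F ∷ [])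
      ∷ [])
  ∷ []

not-mutation-acyclic : ¬ IsMutationAcyclic BQ
not-mutation-acyclic =
  certified⇒¬mutationAcyclic mutationClassOfQ
    (toWitness {a? = all? λ r → isCertified? mutationClassOfQ (lookup mutationClassOfQ r)} _)
    {r = 0F}
    (relabelledBy⇒≅ (λ i → i)
      (toWitness {a? = relabelledBy? (λ i → i) BQ (rep mutationClassOfQ 0F)} _))

lemma4p16 : (¬ ∃ (λ A → IsQuasiCartanCompanion BQ A × IsAdmissible BQ A))
            × ¬ IsMutationAcyclic BQ
lemma4p16 = no-admissible-companion , not-mutation-acyclic
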